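{- Let $w \ge 1$ be an integer and $J_m = (2^m-(-1)^m)/3$. For every integer $N$ with $J_{w+1} < N \le J_{w+2}$ we have $f(N) = w$, and for every integer $N$ with $J_w < N \le J_{w+1}$ we have $r(N) = w$.
   Context: Setting (alternator coin problem): There are $N$ identical-looking coins. All but one are real and have the same weight. The remaining coin, the alternator, behaves as follows: each time it is placed on a balance scale it weighs either the same as a real coin ("acts real") or strictly less than a real coin ("acts fake"), and it switches between these two behaviours every time it is on the scale; while off the scale its behaviour does not change. A weighing places two disjoint sets of coins with the same number of coins on the two pans, and its outcome is one of: the pans balance, the left pan is lighter, or the right pan is lighter. Weighings may be chosen adaptively based on earlier outcomes. A strategy finds the alternator if, for every possible identity of the alternator, the outcomes determine which coin it is. The alternator is in the $f$-state if the next time it is on the scale it will act fake, and in the $r$-state if the next time it is on the scale it will act real. $f(N)$ (resp. $r(N)$) is the smallest number of weighings that guarantees finding the alternator among $N$ coins when it starts in the $f$-state (resp. $r$-state). $J_m=(2^m-(-1)^m)/3$ is the $m$-th Jacobsthal number ($J_0=0,J_1=1,J_2=1,J_3=3,J_4=5,\dots$). -}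

module Defs where

open import Data.Nat using (ℕ; zero; suc; _+_; _∸_; _^_; _<_; _≤_)
open import Data.Nat.DivMod using (_/_; _%_)
open import Data.Bool using (Bool; true; false)
open import Data.Fin using (Fin)
open import Data.Fin.Subset using (Subset; ∣_∣; Empty; _∩_)
open import Data.Vec using (lookup)
open import Data.List using (List; []; _∷_)
open import Data.Product using (Σ; _×_; _,_)
open import Relation.Binary.PropositionalEquality using (_≡_)
open import Relation.Nullary using (¬_)

-- Jacobsthal numbers J_m = (2^m - (-1)^m)/3, written by parity of m.
J : ℕ → ℕ
J m with m % 2
... | zero = (2 ^ m ∸ 1) / 3
... | suc _ = (2 ^ m + 1) / 3

data Outcome : Set where
  balance leftLighter rightLighter : Outcome

-- State of the alternator: f = acts fake next time on the scale, r = acts real.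
data AState : Set where
  fState rState : AState

data Strategy (N : ℕ) : ℕ → Set where
  stop  : ∀ {k} → Strategy N k
  weigh : ∀ {k} (L R : Subset N) → Empty (L ∩ R) → ∣ L ∣ ≡ ∣ R ∣ →
          (Outcome → Strategy N k) → Strategy N (suc k)

-- Result of a weighing when coin a is the alternator in state s:
-- the outcome and the alternator's new state.
weighResult : Bool → Bool → AState → Outcome × AState
weighResult true  _     fState = leftLighter , rState
weighResult false true  fState = rightLighter , rState
weighResult false false fState = balance , fState
weighResult true  _     rState = balance , fState
weighResult false true  rState = balance , fState
weighResult false false rState = balance , rState

trace : ∀ {N k} → Strategy N k → Fin N → AState → List Outcome
trace stop a s = []
trace (weigh L R _ _ next) a s with weighResult (lookup L a) (lookup R a) s
... | o , s' = o ∷ trace (next o) a s'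

Finds : ∀ {N k} → Strategy N k → AState → Set
Finds {N} T s = (a b : Fin N) → trace T a s ≡ trace T b s → a ≡ b

FindableIn : ℕ → AState → ℕ → Set
FindableIn N s k = Σ (Strategy N k) λ T → Finds T s

MinWeighings : ℕ → AState → ℕ → Set
MinWeighings N s w = FindableIn N s w × (∀ k → k < w → ¬ FindableIn N s k)

-- An alternator starting in state s can only produce admissible outcome words: from the
-- f-state a weighing either balances (leaving it in the f-state) or makes its pan lighter
-- (leaving it in the r-state); from the r-state it always balances. Their numbers obey
-- F(k+1) = F(k) + 2R(k) and R(k+1) = F(k), F(0) = R(0) = 1, so F(k) = J(k+2) and R(k) = J(k+1).
-- Distinct coins need distinct outcome words, whence N ≤ F(w) (resp. R(w)). Conversely,
-- keep the candidates in an interval of coins: with 2p candidates in the f-state put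
-- min(p, R(k)) of them on each pan, with b candidates in the r-state put ⌊b/2⌋ on each
-- pan; every outcome leaves a candidate set within the capacities of the remaining k
-- weighings.

module Submission where

open import Data.Bool using (Bool; true; false)
open import Data.Empty using (⊥; ⊥-elim)
open import Data.Fin using (Fin; toℕ; fromℕ<)
open import Data.Fin.Properties using (injective⇒≤; toℕ-fromℕ<; toℕ-injective; toℕ<n)
open import Data.Fin.Subset using (Subset; Empty; ∣_∣; _∩_; _∈_)
open import Data.Fin.Subset.Properties using (x∈p∩q⁻)
import Data.List as List
import Data.List.Properties as List
open import Data.Maybe using (Maybe; nothing; just)
open import Data.Nat
open import Data.Nat.DivMod
open import Data.Nat.Properties
open import Data.Nat.Tactic.RingSolver
open import Data.Product using (_×_; _,_; proj₁; proj₂)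
open import Data.Sum using (_⊎_; inj₁; inj₂)
open import Data.Unit using (⊤; tt)
open import Data.Vec using (Vec; []; _∷_; lookup; replicate; tabulate)
open import Data.Vec.Properties using (∷-injective; lookup∘tabulate; []=⇒lookup)
open import Relation.Nullary using (yes; no)
open import Relation.Binary.PropositionalEquality hiding (J)

open import Defs

data Halving : ℕ → Set where
  even : ∀ h → Halving (h + h)
  odd  : ∀ h → Halving (suc (h + h))

halving : ∀ n → Halving n
halving zero = even 0
halving (suc n) with halving n
... | even h = odd h
... | odd h  = subst Halving (cong suc (+-suc h h)) (even (suc h))

-- Jacobsthal numbers

jacobsthal : ℕ → ℕ
jacobsthal 0 = 0
jacobsthal 1 = 1
jacobsthal (suc (suc m)) = jacobsthal (suc m) + (jacobsthal m + jacobsthal m)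

jacobsthal-+-suc : ∀ m → jacobsthal m + jacobsthal (suc m) ≡ 2 ^ m
jacobsthal-+-suc zero = refl
jacobsthal-+-suc (suc m) =
  trans (regroup (jacobsthal m) (jacobsthal (suc m))) (cong (2 *_) (jacobsthal-+-suc m))
  where
  regroup : ∀ a b → b + (b + (a + a)) ≡ 2 * (a + b)
  regroup = solve-∀

jacobsthal-odd : ∀ h → jacobsthal (suc (h + h)) ≡ suc (jacobsthal (h + h) + jacobsthal (h + h))
jacobsthal-odd zero = refl
jacobsthal-odd (suc h) rewrite +-suc h h | jacobsthal-odd h = step (jacobsthal (h + h))
  where
  step : ∀ a → let b = suc (a + a) in b + (a + a) + (b + b) ≡ suc ((b + (a + a)) + (b + (a + a)))
  step = solve-∀

jacobsthal-suc-positive : ∀ m → 0 < jacobsthal (suc m)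
jacobsthal-suc-positive zero    = s≤s z≤n
jacobsthal-suc-positive (suc m) = m≤n⇒m≤n+o _ (jacobsthal-suc-positive m)

jacobsthal-mono-≤ : ∀ {m n} → m ≤ n → jacobsthal m ≤ jacobsthal n
jacobsthal-mono-≤ m≤n = go (≤⇒≤′ m≤n)
  where
  ≤-suc : ∀ m → jacobsthal m ≤ jacobsthal (suc m)
  ≤-suc zero          = z≤n
  ≤-suc (suc zero)    = ≤-refl
  ≤-suc (suc (suc m)) = m≤m+n _ _
  go : ∀ {m n} → m ≤′ n → jacobsthal m ≤ jacobsthal n
  go ≤′-refl            = ≤-refl
  go (≤′-step {n} m≤′n) = ≤-trans (go m≤′n) (≤-suc n)

n+n≡n*2 : ∀ n → n + n ≡ n * 2
n+n≡n*2 = solve-∀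

n+n%2≡0 : ∀ n → (n + n) % 2 ≡ 0
n+n%2≡0 n = trans (cong (_% 2) (n+n≡n*2 n)) (m*n%n≡0 n 2)

[1+n+n]%2≡1 : ∀ n → suc (n + n) % 2 ≡ 1
[1+n+n]%2≡1 n = trans (cong (λ x → suc x % 2) (n+n≡n*2 n)) ([m+kn]%n≡m%n 1 n 2)

J-even : ∀ h → J (h + h) ≡ jacobsthal (h + h)
J-even h rewrite n+n%2≡0 h = begin
  (2 ^ (h + h) ∸ 1) / 3
    ≡⟨ cong (λ x → (x ∸ 1) / 3) (sym (jacobsthal-+-suc (h + h))) ⟩
  (a + jacobsthal (suc (h + h)) ∸ 1) / 3
    ≡⟨ cong (λ x → (a + x ∸ 1) / 3) (jacobsthal-odd h) ⟩
  (a + suc (a + a) ∸ 1) / 3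
    ≡⟨ cong (λ x → (x ∸ 1) / 3) (thrice a) ⟩
  a * 3 / 3
    ≡⟨ m*n/n≡m a 3 ⟩
  a ∎
  where
  open ≡-Reasoning
  a : ℕ
  a = jacobsthal (h + h)
  thrice : ∀ a → a + suc (a + a) ≡ suc (a * 3)
  thrice = solve-∀

J-odd : ∀ h → J (suc (h + h)) ≡ jacobsthal (suc (h + h))
J-odd h rewrite [1+n+n]%2≡1 h = begin
  (2 ^ suc (h + h) + 1) / 3
    ≡⟨ cong (λ x → (x + 1) / 3) (sym (jacobsthal-+-suc (suc (h + h)))) ⟩
  (b + (b + (a + a)) + 1) / 3
    ≡⟨ cong (λ x → (x + (x + (a + a)) + 1) / 3) (jacobsthal-odd h) ⟩
  (suc (a + a) + (suc (a + a) + (a + a)) + 1) / 3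
    ≡⟨ cong (_/ 3) (thrice a) ⟩
  suc (a + a) * 3 / 3
    ≡⟨ m*n/n≡m (suc (a + a)) 3 ⟩
  suc (a + a)
    ≡⟨ sym (jacobsthal-odd h) ⟩
  b ∎
  where
  open ≡-Reasoning
  a b : ℕ
  a = jacobsthal (h + h)
  b = jacobsthal (suc (h + h))
  thrice : ∀ a → suc (a + a) + (suc (a + a) + (a + a)) + 1 ≡ suc (a + a) * 3
  thrice = solve-∀

J≡jacobsthal : ∀ m → J m ≡ jacobsthal m
J≡jacobsthal m with halving m
... | even h = J-even h
... | odd h  = J-odd h

-- The numbers F(k) and R(k) of admissible outcome words of length k.
capacity : AState → ℕ → ℕ
capacity fState k = jacobsthal (2 + k)
capacity rState k = jacobsthal (1 + k)

capacity-mono-≤ : ∀ s {m n} → m ≤ n → capacity s m ≤ capacity s n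
capacity-mono-≤ fState m≤n = jacobsthal-mono-≤ (s≤s (s≤s m≤n))
capacity-mono-≤ rState m≤n = jacobsthal-mono-≤ (s≤s m≤n)

-- Counting outcome words

paddedTrace : ∀ {N k} → Strategy N k → Fin N → AState → Vec Outcome k
paddedTrace {k = k} stop a s = replicate k balance
paddedTrace (weigh L R _ _ next) a s with weighResult (lookup L a) (lookup R a) s
... | o , s′ = o ∷ paddedTrace (next o) a s′

paddedTrace≡⇒trace≡ : ∀ {N k} (T : Strategy N k) a b sa sb →
  paddedTrace T a sa ≡ paddedTrace T b sb → trace T a sa ≡ trace T b sb
paddedTrace≡⇒trace≡ stop a b sa sb _ = refl
paddedTrace≡⇒trace≡ (weigh L R _ _ next) a b sa sb eq
  with weighResult (lookup L a) (lookup R a) sa | weighResult (lookup L b) (lookup R b) sb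
... | o , sa′ | _ , sb′ with ∷-injective eq
... | refl , eq′ = cong (o List.∷_) (paddedTrace≡⇒trace≡ (next o) a b sa′ sb′ eq′)

Admissible : ∀ {k} → AState → Vec Outcome k → Set
Admissible s [] = ⊤
Admissible fState (balance ∷ w) = Admissible fState w
Admissible fState (leftLighter ∷ w) = Admissible rState w
Admissible fState (rightLighter ∷ w) = Admissible rState w
Admissible rState (balance ∷ w) = Admissible fState w
Admissible rState (leftLighter ∷ w) = ⊥
Admissible rState (rightLighter ∷ w) = ⊥

Admissible-r⇒f : ∀ {k} (w : Vec Outcome k) → Admissible rState w → Admissible fState w
Admissible-r⇒f [] _ = tt
Admissible-r⇒f (balance ∷ w) adm = adm

replicate-balance-admissible : ∀ k s → Admissible s (replicate k balance)
replicate-balance-admissible zero s = tt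
replicate-balance-admissible (suc k) fState = replicate-balance-admissible k fState
replicate-balance-admissible (suc k) rState = replicate-balance-admissible k fState

weighResult-admissible : ∀ {k} l r s (w : Vec Outcome k) →
  Admissible (proj₂ (weighResult l r s)) w → Admissible s (proj₁ (weighResult l r s) ∷ w)
weighResult-admissible true  _     fState w adm = adm
weighResult-admissible false true  fState w adm = adm
weighResult-admissible false false fState w adm = adm
weighResult-admissible true  _     rState w adm = adm
weighResult-admissible false true  rState w adm = adm
weighResult-admissible false false rState w adm = Admissible-r⇒f w adm

paddedTrace-admissible : ∀ {N k} (T : Strategy N k) a s → Admissible s (paddedTrace T a s)
paddedTrace-admissible {k = k} stop a s = replicate-balance-admissible k s
paddedTrace-admissible (weigh L R _ _ next) a s =
  weighResult-admissible (lookup L a) (lookup R a) s _ (paddedTrace-admissible (next _) a _)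

encode : ∀ {k} → AState → Vec Outcome k → ℕ
encode s [] = 0
encode fState (balance ∷ w) = encode fState w
encode {suc k} fState (leftLighter ∷ w) = capacity fState k + encode rState w
encode {suc k} fState (rightLighter ∷ w) = capacity fState k + capacity rState k + encode rState w
encode rState (_ ∷ w) = encode fState w

encode<capacity : ∀ {k} s (w : Vec Outcome k) → Admissible s w → encode s w < capacity s k
encode<capacity fState [] _ = s≤s z≤n
encode<capacity rState [] _ = s≤s z≤n
encode<capacity {suc k} fState (balance ∷ w) adm =
  m≤n⇒m≤n+o (capacity rState k + capacity rState k) (encode<capacity fState w adm)
encode<capacity {suc k} fState (leftLighter ∷ w) adm =
  +-monoʳ-< (capacity fState k) (m≤n⇒m≤n+o (capacity rState k) (encode<capacity rState w adm))
encode<capacity {suc k} fState (rightLighter ∷ w) adm =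
  ≤-trans (+-monoʳ-< (capacity fState k + capacity rState k) (encode<capacity rState w adm))
    (≤-reflexive (+-assoc (capacity fState k) (capacity rState k) (capacity rState k)))
encode<capacity {suc k} rState (balance ∷ w) adm = encode<capacity fState w adm

private
  <⇒≢+ : ∀ {x m y} → x < m → x ≢ m + y
  <⇒≢+ {y = y} x<m refl = m+n≮m _ y x<m

encode-injective : ∀ {k} s (w w′ : Vec Outcome k) → Admissible s w → Admissible s w′ →
  encode s w ≡ encode s w′ → w ≡ w′
encode-injective s [] [] _ _ _ = refl
encode-injective fState (balance ∷ w) (balance ∷ w′) adm adm′ eq =
  cong (balance ∷_) (encode-injective fState w w′ adm adm′ eq)
encode-injective {suc k} fState (leftLighter ∷ w) (leftLighter ∷ w′) adm adm′ eq =
  cong (leftLighter ∷_)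
    (encode-injective rState w w′ adm adm′ (+-cancelˡ-≡ (capacity fState k) _ _ eq))
encode-injective {suc k} fState (rightLighter ∷ w) (rightLighter ∷ w′) adm adm′ eq =
  cong (rightLighter ∷_)
    (encode-injective rState w w′ adm adm′
      (+-cancelˡ-≡ (capacity fState k + capacity rState k) _ _ eq))
encode-injective rState (balance ∷ w) (balance ∷ w′) adm adm′ eq =
  cong (balance ∷_) (encode-injective fState w w′ adm adm′ eq)
encode-injective {suc k} fState (balance ∷ w) (leftLighter ∷ w′) adm _ eq =
  ⊥-elim (<⇒≢+ (encode<capacity fState w adm) eq)
encode-injective {suc k} fState (leftLighter ∷ w) (balance ∷ w′) _ adm′ eq =
  ⊥-elim (<⇒≢+ (encode<capacity fState w′ adm′) (sym eq))
encode-injective {suc k} fState (balance ∷ w) (rightLighter ∷ w′) adm _ eq =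
  ⊥-elim (<⇒≢+ (m≤n⇒m≤n+o _ (encode<capacity fState w adm)) eq)
encode-injective {suc k} fState (rightLighter ∷ w) (balance ∷ w′) _ adm′ eq =
  ⊥-elim (<⇒≢+ (m≤n⇒m≤n+o _ (encode<capacity fState w′ adm′)) (sym eq))
encode-injective {suc k} fState (leftLighter ∷ w) (rightLighter ∷ w′) adm _ eq =
  ⊥-elim (<⇒≢+ (encode<capacity rState w adm)
    (+-cancelˡ-≡ (capacity fState k) _ _ (trans eq (+-assoc (capacity fState k) _ _))))
encode-injective {suc k} fState (rightLighter ∷ w) (leftLighter ∷ w′) _ adm′ eq =
  ⊥-elim (<⇒≢+ (encode<capacity rState w′ adm′)
    (+-cancelˡ-≡ (capacity fState k) _ _ (trans (sym eq) (+-assoc (capacity fState k) _ _))))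

findable⇒≤capacity : ∀ {N s k} → FindableIn N s k → N ≤ capacity s k
findable⇒≤capacity {N} {s} {k} (T , finds) = injective⇒≤ {f = rank} rank-injective
  where
  rank : Fin N → Fin (capacity s k)
  rank a = fromℕ< (encode<capacity s (paddedTrace T a s) (paddedTrace-admissible T a s))
  rank-injective : ∀ {a b} → rank a ≡ rank b → a ≡ b
  rank-injective {a} {b} eq = finds a b (paddedTrace≡⇒trace≡ T a b s s
    (encode-injective s _ _ (paddedTrace-admissible T a s) (paddedTrace-admissible T b s)
      (trans (sym (toℕ-fromℕ< _)) (trans (cong toℕ eq) (toℕ-fromℕ< _)))))

inInterval : ℕ → ℕ → ℕ → Bool
inInterval zero    zero    x       = false
inInterval zero    (suc t) zero    = true
inInterval zero    (suc t) (suc x) = inInterval zero t x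
inInterval (suc lo) t      zero    = false
inInterval (suc lo) t      (suc x) = inInterval lo t x

inInterval-inside : ∀ lo t x → lo ≤ x → x < lo + t → inInterval lo t x ≡ true
inInterval-inside zero     (suc t) zero    _          _         = refl
inInterval-inside zero     (suc t) (suc x) _          (s≤s x<t) = inInterval-inside zero t x z≤n x<t
inInterval-inside (suc lo) t       (suc x) (s≤s lo≤x) (s≤s x<)  = inInterval-inside lo t x lo≤x x<

inInterval-above : ∀ lo t x → lo + t ≤ x → inInterval lo t x ≡ false
inInterval-above zero     zero    x       _        = refl
inInterval-above zero     (suc t) (suc x) (s≤s t≤x) = inInterval-above zero t x t≤x
inInterval-above (suc lo) t       (suc x) (s≤s le)  = inInterval-above lo t x le

inInterval-below : ∀ lo t x → x < lo → inInterval lo t x ≡ false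
inInterval-below (suc lo) t zero    _           = refl
inInterval-below (suc lo) t (suc x) (s≤s x<lo) = inInterval-below lo t x x<lo

interval : ∀ N → ℕ → ℕ → Subset N
interval N lo t = tabulate (λ i → inInterval lo t (toℕ i))

lookup-interval : ∀ {N} lo t (i : Fin N) → lookup (interval N lo t) i ≡ inInterval lo t (toℕ i)
lookup-interval lo t = lookup∘tabulate (λ i → inInterval lo t (toℕ i))

∣interval∣ : ∀ N lo t → lo + t ≤ N → ∣ interval N lo t ∣ ≡ t
∣interval∣ zero    zero     zero    _         = refl
∣interval∣ (suc N) zero     zero    _         = ∣interval∣ N zero zero z≤n
∣interval∣ (suc N) zero     (suc t) (s≤s t≤N) = cong suc (∣interval∣ N zero t t≤N)
∣interval∣ (suc N) (suc lo) t       (s≤s le)  = ∣interval∣ N lo t le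

∈interval⇒inInterval : ∀ {N} lo t {i : Fin N} →
  i ∈ interval N lo t → inInterval lo t (toℕ i) ≡ true
∈interval⇒inInterval lo t {i} i∈ = trans (sym (lookup-interval lo t i)) ([]=⇒lookup i∈)

private
  true≢false : true ≢ false
  true≢false ()

adjacent-intervals-disjoint : ∀ N lo t t′ → Empty (interval N lo t ∩ interval N (lo + t) t′)
adjacent-intervals-disjoint N lo t t′ (i , i∈L∩R) with x∈p∩q⁻ _ _ i∈L∩R | toℕ i <? lo + t
... | _ , i∈R | yes i<mid =
  true≢false (trans (sym (∈interval⇒inInterval (lo + t) t′ i∈R))
                    (inInterval-below (lo + t) t′ (toℕ i) i<mid))
... | i∈L , _ | no i≮mid =
  true≢false (trans (sym (∈interval⇒inInterval lo t i∈L))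
                    (inInterval-above lo t (toℕ i) (≮⇒≥ i≮mid)))

data Position (lo t x : ℕ) : Bool → Bool → Set where
  onLeft   : x < lo + t → Position lo t x true false
  onRight  : lo + t ≤ x → x < lo + t + t → Position lo t x false true
  offScale : lo + t + t ≤ x → Position lo t x false false

position : ∀ lo t x → lo ≤ x → Position lo t x (inInterval lo t x) (inInterval (lo + t) t x)
position lo t x lo≤x with x <? lo + t | x <? lo + t + t
... | yes x<mid | _
  rewrite inInterval-inside lo t x lo≤x x<mid | inInterval-below (lo + t) t x x<mid = onLeft x<mid
... | no x≮mid | yes x<hi
  rewrite inInterval-above lo t x (≮⇒≥ x≮mid)
        | inInterval-inside (lo + t) t x (≮⇒≥ x≮mid) x<hi =
  onRight (≮⇒≥ x≮mid) x<hi
... | no x≮mid | no x≮hi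
  rewrite inInterval-above lo t x (≮⇒≥ x≮mid)
        | inInterval-above (lo + t) t x (≮⇒≥ x≮hi) =
  offScale (≮⇒≥ x≮hi)

offScale-result : ∀ s → weighResult false false s ≡ (balance , s)
offScale-result fState = refl
offScale-result rState = refl

tailSize : Maybe AState → ℕ
tailSize nothing  = 0
tailSize (just _) = 1

data Config : Set where
  rBlock : (lo b : ℕ) → Config
  fPairs : (lo p : ℕ) → Maybe AState → Config

IsCandidate : Config → ℕ → AState → Set
IsCandidate (rBlock lo b) x s = lo ≤ x × x < lo + b × s ≡ rState
IsCandidate (fPairs lo p tail) x s =
  (lo ≤ x × x < lo + (p + p) × s ≡ fState) ⊎ (x ≡ lo + (p + p) × tail ≡ just s)

start : Config → ℕ
start (rBlock lo _)   = lo
start (fPairs lo _ _) = lo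

size : Config → ℕ
size (rBlock _ b)      = b
size (fPairs _ p tail) = p + p + tailSize tail

end : Config → ℕ
end c = start c + size c

Fits : ℕ → Config → Set
Fits k (rBlock _ b)      = b ≤ capacity rState k
Fits k (fPairs _ p tail) = p + p + tailSize tail ≤ capacity fState k

candidate-bounds : ∀ c {x s} → IsCandidate c x s → start c ≤ x × x < end c
candidate-bounds (rBlock lo b) (lo≤x , x<end , _) = lo≤x , x<end
candidate-bounds (fPairs lo p tail) (inj₁ (lo≤x , x<lo+2p , _)) =
  lo≤x , <-≤-trans x<lo+2p (+-monoʳ-≤ lo (m≤m+n (p + p) (tailSize tail)))
candidate-bounds (fPairs lo p .(just _)) (inj₂ (refl , refl)) =
  m≤m+n lo (p + p) , +-monoʳ-< lo (m<m+n (p + p) (s≤s z≤n))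

only-candidate : ∀ c {x s} → Fits 0 c → IsCandidate c x s → x ≡ start c
only-candidate c {x} fits cand with candidate-bounds c cand
... | lo≤x , x<end = ≤-antisym (m<1+n⇒m≤n x<1+lo) lo≤x
  where
  size≤1 : ∀ c → Fits 0 c → size c ≤ 1
  size≤1 (rBlock _ _)   fits = fits
  size≤1 (fPairs _ _ _) fits = fits
  x<1+lo : x < suc (start c)
  x<1+lo = <-≤-trans x<end
    (≤-trans (+-monoʳ-≤ (start c) (size≤1 c fits)) (≤-reflexive (+-comm (start c) 1)))

half : ∀ {n} → Halving n → ℕ
half (even h) = h
half (odd h)  = h

pairUp : ∀ {n} → ℕ → AState → Halving n → Config
pairUp lo s (even h) = fPairs lo h nothing
pairUp lo s (odd h)  = fPairs lo h (just s)

end-pairUp : ∀ {n} lo s (hv : Halving n) → end (pairUp lo s hv) ≡ lo + n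
end-pairUp lo s (even h) = cong (lo +_) (+-identityʳ (h + h))
end-pairUp lo s (odd h)  = cong (lo +_) (+-comm (h + h) 1)

pairUp-fits : ∀ {n k} lo s (hv : Halving n) → n ≤ capacity fState k → Fits k (pairUp lo s hv)
pairUp-fits lo s (even h) n≤cap = ≤-trans (≤-reflexive (+-identityʳ (h + h))) n≤cap
pairUp-fits lo s (odd h)  n≤cap = ≤-trans (≤-reflexive (+-comm (h + h) 1)) n≤cap

pairUp-paired : ∀ {n x} lo s (hv : Halving n) → lo ≤ x → x < lo + (half hv + half hv) →
  IsCandidate (pairUp lo s hv) x fState
pairUp-paired lo s (even h) lo≤x x< = inj₁ (lo≤x , x< , refl)
pairUp-paired lo s (odd h)  lo≤x x< = inj₁ (lo≤x , x< , refl)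

pairUp-unpaired : ∀ {n x} lo s (hv : Halving n) → lo + (half hv + half hv) ≤ x → x < lo + n →
  IsCandidate (pairUp lo s hv) x s
pairUp-unpaired lo s (even h) ≤x x< = ⊥-elim (<⇒≱ x< ≤x)
pairUp-unpaired lo s (odd h)  ≤x x< =
  inj₂ (≤-antisym (≤-pred (≤-trans x< (≤-reflexive (+-suc lo (h + h))))) ≤x , refl)

pairs-split : ∀ lo {t p} → t ≤ p → lo + t + t + ((p ∸ t) + (p ∸ t)) ≡ lo + (p + p)
pairs-split lo {t} {p} t≤p = begin
  lo + t + t + ((p ∸ t) + (p ∸ t))         ≡⟨ regroup lo t (p ∸ t) ⟩
  lo + ((t + (p ∸ t)) + (t + (p ∸ t)))     ≡⟨ cong (λ q → lo + (q + q)) (m+[n∸m]≡n t≤p) ⟩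
  lo + (p + p)                             ∎
  where
  open ≡-Reasoning
  regroup : ∀ lo t d → lo + t + t + (d + d) ≡ lo + ((t + d) + (t + d))
  regroup = solve-∀

pans≤pairs : ∀ lo {t p} → t ≤ p → lo + t + t ≤ lo + (p + p)
pans≤pairs lo t≤p = ≤-trans (m≤m+n _ _) (≤-reflexive (pairs-split lo t≤p))

leftover-fits : ∀ {u} v p {e} → e ≤ u → p + p + e ≤ u + (v + v) →
  (p ∸ p ⊓ v) + (p ∸ p ⊓ v) + e ≤ u
leftover-fits {u} v p {e} e≤u fits with ≤-total p v
... | inj₁ p≤v rewrite m≤n⇒m⊓n≡m p≤v | n∸n≡0 p = e≤u
... | inj₂ v≤p rewrite m≥n⇒m⊓n≡n v≤p = +-cancelˡ-≤ (v + v) _ u (begin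
  v + v + ((p ∸ v) + (p ∸ v) + e)   ≡⟨ regroup v (p ∸ v) e ⟩
  (v + (p ∸ v)) + (v + (p ∸ v)) + e ≡⟨ cong (λ q → q + q + e) (m+[n∸m]≡n v≤p) ⟩
  p + p + e                         ≤⟨ fits ⟩
  u + (v + v)                       ≡⟨ +-comm u (v + v) ⟩
  v + v + u                         ∎)
  where
  open ≤-Reasoning
  regroup : ∀ v d e → v + v + (d + d + e) ≡ (v + d) + (v + d) + e
  regroup = solve-∀

-- At most capacity rState k coins per pan: a lighter pan leaves its coins as
-- r-candidates, to be found with the remaining k weighings.
pairsOnScale : ℕ → ℕ → ℕ
pairsOnScale k p = p ⊓ capacity rState k

pairsOnScale≤ : ∀ k p → pairsOnScale k p ≤ p
pairsOnScale≤ k p = m⊓n≤m p (capacity rState k)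

panSize : ℕ → Config → ℕ
panSize k (rBlock _ b)   = half (halving b)
panSize k (fPairs _ p _) = pairsOnScale k p

-- An alternator in the r-state always balances, so weighing an r-block only turns
-- the coins on the scale into f-candidates.
next : ℕ → Config → Outcome → Config
next k (rBlock lo b) _                 = pairUp lo rState (halving b)
next k (fPairs lo p tail) leftLighter  = rBlock lo (pairsOnScale k p)
next k (fPairs lo p tail) rightLighter = rBlock (lo + pairsOnScale k p) (pairsOnScale k p)
next k (fPairs lo p tail) balance      =
  fPairs (lo + pairsOnScale k p + pairsOnScale k p) (p ∸ pairsOnScale k p) tail

tailSize≤capacity : ∀ tail k → tailSize tail ≤ capacity fState k
tailSize≤capacity nothing  k = z≤n
tailSize≤capacity (just _) k = jacobsthal-suc-positive (suc k)

pans-within : ∀ k c → start c + panSize k c + panSize k c ≤ end c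
pans-within k (rBlock lo b) with halving b
... | even h = ≤-reflexive (+-assoc lo h h)
... | odd h  = ≤-trans (≤-reflexive (+-assoc lo h h)) (+-monoʳ-≤ lo (n≤1+n (h + h)))
pans-within k (fPairs lo p tail) =
  ≤-trans (pans≤pairs lo (pairsOnScale≤ k p)) (+-monoʳ-≤ lo (m≤m+n (p + p) (tailSize tail)))

next-within : ∀ k c o → end (next k c o) ≤ end c
next-within k (rBlock lo b) o = ≤-reflexive (end-pairUp lo rState (halving b))
next-within k (fPairs lo p tail) leftLighter =
  +-monoʳ-≤ lo (≤-trans (pairsOnScale≤ k p) (≤-trans (m≤m+n p p) (m≤m+n (p + p) (tailSize tail))))
next-within k (fPairs lo p tail) rightLighter = pans-within k (fPairs lo p tail)
next-within k (fPairs lo p tail) balance = ≤-reflexive (begin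
  lo + t + t + ((p ∸ t) + (p ∸ t) + e)   ≡⟨ sym (+-assoc (lo + t + t) _ e) ⟩
  lo + t + t + ((p ∸ t) + (p ∸ t)) + e   ≡⟨ cong (_+ e) (pairs-split lo (pairsOnScale≤ k p)) ⟩
  lo + (p + p) + e                       ≡⟨ +-assoc lo (p + p) e ⟩
  lo + (p + p + e)                       ∎)
  where
  open ≡-Reasoning
  t e : ℕ
  t = pairsOnScale k p
  e = tailSize tail

next-fits : ∀ k c o → Fits (suc k) c → Fits k (next k c o)
next-fits k (rBlock lo b) o fits = pairUp-fits lo rState (halving b) fits
next-fits k (fPairs lo p tail) leftLighter  fits = m⊓n≤n p _
next-fits k (fPairs lo p tail) rightLighter fits = m⊓n≤n p _
next-fits k (fPairs lo p tail) balance      fits =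
  leftover-fits (capacity rState k) p (tailSize≤capacity tail k) fits

weighAt : ℕ → Config → ℕ → AState → Outcome × AState
weighAt k c x =
  weighResult (inInterval (start c) (panSize k c) x) (inInterval (start c + panSize k c) (panSize k c) x)

next-candidate : ∀ k c {x s} → IsCandidate c x s →
  IsCandidate (next k c (proj₁ (weighAt k c x s))) x (proj₂ (weighAt k c x s))
next-candidate k (rBlock lo b) {x} (lo≤x , x<end , refl) with halving b
... | hv with inInterval lo (half hv) x | inInterval (lo + half hv) (half hv) x
            | position lo (half hv) x lo≤x
...   | _ | _ | onLeft x<mid =
  pairUp-paired lo rState hv lo≤x (<-≤-trans x<mid (+-monoʳ-≤ lo (m≤m+n (half hv) (half hv))))
...   | _ | _ | onRight _ x<hi =
  pairUp-paired lo rState hv lo≤x (<-≤-trans x<hi (≤-reflexive (+-assoc lo _ _)))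
...   | _ | _ | offScale hi≤x =
  pairUp-unpaired lo rState hv (≤-trans (≤-reflexive (sym (+-assoc lo _ _))) hi≤x) x<end
next-candidate k (fPairs lo p tail) {x} (inj₁ (lo≤x , x<end , refl))
  with inInterval lo (pairsOnScale k p) x | inInterval (lo + pairsOnScale k p) (pairsOnScale k p) x
     | position lo (pairsOnScale k p) x lo≤x
... | _ | _ | onLeft x<mid          = lo≤x , x<mid , refl
... | _ | _ | onRight mid≤x x<hi    = mid≤x , x<hi , refl
... | _ | _ | offScale hi≤x         =
  inj₁ (hi≤x , <-≤-trans x<end (≤-reflexive (sym (pairs-split lo (pairsOnScale≤ k p)))) , refl)
next-candidate k (fPairs lo p .(just s)) {s = s} (inj₂ (refl , refl))
  rewrite inInterval-above lo (pairsOnScale k p) (lo + (p + p))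
            (≤-trans (m≤m+n _ (pairsOnScale k p)) (pans≤pairs lo (pairsOnScale≤ k p)))
        | inInterval-above (lo + pairsOnScale k p) (pairsOnScale k p) (lo + (p + p))
            (pans≤pairs lo (pairsOnScale≤ k p))
        | offScale-result s = inj₂ (sym (pairs-split lo (pairsOnScale≤ k p)) , refl)

-- The halving strategy

leftPan rightPan : ∀ N k → Config → Subset N
leftPan  N k c = interval N (start c) (panSize k c)
rightPan N k c = interval N (start c + panSize k c) (panSize k c)

pans-balanced : ∀ {N} k c → end c ≤ N → ∣ leftPan N k c ∣ ≡ ∣ rightPan N k c ∣
pans-balanced {N} k c c≤N =
  trans (∣interval∣ N (start c) (panSize k c) (m+n≤o⇒m≤o _ pans≤N))
        (sym (∣interval∣ N (start c + panSize k c) (panSize k c) pans≤N))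
  where
  pans≤N : start c + panSize k c + panSize k c ≤ N
  pans≤N = ≤-trans (pans-within k c) c≤N

strategy : ∀ {N} k (c : Config) → end c ≤ N → Strategy N k
strategy zero c _ = stop
strategy {N} (suc k) c c≤N =
  weigh (leftPan N k c) (rightPan N k c)
    (adjacent-intervals-disjoint N (start c) (panSize k c) (panSize k c)) (pans-balanced k c c≤N)
    λ o → strategy k (next k c o) (≤-trans (next-within k c o) c≤N)

candidate-after-weighing : ∀ {N} k c (a : Fin N) {s} → IsCandidate c (toℕ a) s →
  let r = weighResult (lookup (leftPan N k c) a) (lookup (rightPan N k c) a) s
  in IsCandidate (next k c (proj₁ r)) (toℕ a) (proj₂ r)
candidate-after-weighing k c a cand
  rewrite lookup-interval (start c) (panSize k c) a
        | lookup-interval (start c + panSize k c) (panSize k c) a = next-candidate k c cand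

strategy-separates : ∀ {N} k c (c≤N : end c ≤ N) → Fits k c →
  (a b : Fin N) {sa sb : AState} → IsCandidate c (toℕ a) sa → IsCandidate c (toℕ b) sb →
  trace (strategy k c c≤N) a sa ≡ trace (strategy k c c≤N) b sb → a ≡ b
strategy-separates zero c _ fits a b ca cb _ =
  toℕ-injective (trans (only-candidate c fits ca) (sym (only-candidate c fits cb)))
strategy-separates {N} (suc k) c c≤N fits a b {sa} {sb} ca cb eq
  with weighResult (lookup (leftPan N k c) a) (lookup (rightPan N k c) a) sa
     | candidate-after-weighing k c a ca
     | weighResult (lookup (leftPan N k c) b) (lookup (rightPan N k c) b) sb
     | candidate-after-weighing k c b cb
... | o , _ | ca′ | _ , _ | cb′ with List.∷-injective eq
... | refl , eq′ = strategy-separates k (next k c o) _ (next-fits k c o fits) a b ca′ cb′ eq′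

initial : AState → ℕ → Config
initial fState N = pairUp 0 fState (halving N)
initial rState N = rBlock 0 N

end-initial : ∀ s N → end (initial s N) ≡ N
end-initial fState N = end-pairUp 0 fState (halving N)
end-initial rState N = refl

initial-fits : ∀ s {N k} → N ≤ capacity s k → Fits k (initial s N)
initial-fits fState {N} N≤cap = pairUp-fits 0 fState (halving N) N≤cap
initial-fits rState     N≤cap = N≤cap

initial-candidate : ∀ s {N x} → x < N → IsCandidate (initial s N) x s
initial-candidate fState {N} {x} x<N with x <? half (halving N) + half (halving N)
... | yes x<paired = pairUp-paired 0 fState (halving N) z≤n x<paired
... | no x≮paired  = pairUp-unpaired 0 fState (halving N) (≮⇒≥ x≮paired) x<N
initial-candidate rState x<N = z≤n , x<N , refl

≤capacity⇒findable : ∀ {N s k} → N ≤ capacity s k → FindableIn N s k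
≤capacity⇒findable {N} {s} {k} N≤cap = strategy k (initial s N) c≤N , λ a b →
  strategy-separates k (initial s N) c≤N (initial-fits s N≤cap) a b
    (initial-candidate s (toℕ<n a)) (initial-candidate s (toℕ<n b))
  where
  c≤N : end (initial s N) ≤ N
  c≤N = ≤-reflexive (end-initial s N)

capacity-gap⇒minWeighings : ∀ {N s k} → capacity s k < N → N ≤ capacity s (suc k) →
  MinWeighings N s (suc k)
capacity-gap⇒minWeighings {s = s} {k} cap<N N≤cap =
  ≤capacity⇒findable N≤cap ,
  λ j j<1+k findable →
    <⇒≱ cap<N (≤-trans (findable⇒≤capacity findable) (capacity-mono-≤ s (m<1+n⇒m≤n j<1+k)))

theorem1 : (w : ℕ) → 1 ≤ w →
    ((N : ℕ) → J (suc w) < N → N ≤ J (suc (suc w)) → MinWeighings N fState w)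
    × ((N : ℕ) → J w < N → N ≤ J (suc w) → MinWeighings N rState w)
theorem1 (suc w) _
  rewrite J≡jacobsthal (suc w) | J≡jacobsthal (suc (suc w)) | J≡jacobsthal (suc (suc (suc w))) =
  (λ _ → capacity-gap⇒minWeighings) , (λ _ → capacity-gap⇒minWeighings)
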